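{- The leaf-removal game on any chess-colored (finite) tree is balanced.
   Context: Here a tree is a finite tree in the graph-theoretic sense, with each vertex colored black or white; a chess coloring is one where adjacent vertices have different colors. The leaf-removal game: White and Black alternately remove a leaf of the current tree (a vertex of degree at most one) of their own color; a player who cannot move loses. A position (the current tree with its coloring) is balanced if (i) every position reachable from it in one move (by either player) is balanced, and (ii) whenever all its removable elements (its leaves) are of the same color, at least half of its vertices have that color. -}

module Defs where

open import Data.Nat using (ℕ; _≤_; _*_; _+_)
open import Data.Bool using (Bool; true; false)
open import Data.Fin using (Fin)
open import Data.Fin.Subset using (Subset; _∈_; _∩_; _-_; ∣_∣; ⊤)
open import Data.List using (List; []; _∷_; _++_; length)
open import Data.List.Relation.Unary.Linked using (Linked)
open import Data.List.Relation.Unary.Unique.Propositional using (Unique)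
open import Data.Vec using (tabulate)
open import Data.Product using (Σ; ∃; _×_)
open import Relation.Binary.PropositionalEquality using (_≡_; _≢_)
open import Relation.Nullary using (¬_)

data Colour : Set where
  white black : Colour

Graph : ℕ → Set
Graph n = Fin n → Fin n → Bool

module _ {n : ℕ} (E : Graph n) where

  Adj : Fin n → Fin n → Set
  Adj u v = E u v ≡ true

  IsSimple : Set
  IsSimple = (∀ u v → E u v ≡ E v u) × (∀ v → E v v ≡ false)

  data Walk : Fin n → Fin n → Set where
    here : ∀ {u} → Walk u u
    step : ∀ {u v w} → Adj u v → Walk v w → Walk u w

  Connected : Set
  Connected = ∀ u v → Walk u v

  Cycle : Set
  Cycle = Σ (Fin n) λ u → Σ (List (Fin n)) λ ws →
            (2 ≤ length ws) × Unique (u ∷ ws) × Linked Adj (u ∷ ws ++ u ∷ [])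

  Acyclic : Set
  Acyclic = ¬ Cycle

  IsTree : Set
  IsTree = (1 ≤ n) × IsSimple × Connected × Acyclic

  IsChess : (Fin n → Colour) → Set
  IsChess col = ∀ u v → Adj u v → col u ≢ col v

module Game {n : ℕ} (E : Graph n) (col : Fin n → Colour) where

  open import Data.Bool using (if_then_else_)

  nbhd : Fin n → Subset n
  nbhd v = tabulate (E v)

  sameColour : Colour → Colour → Bool
  sameColour white white = true
  sameColour black black = true
  sameColour _ _ = false

  colourSet : Colour → Subset n
  colourSet c = tabulate λ v → sameColour (col v) c

  -- A position is the (induced) subtree on a vertex set S ⊆ Fin n.
  -- v is a leaf (removable) of S: v ∈ S and v has degree ≤ 1 within S.
  IsLeaf : Subset n → Fin n → Set
  IsLeaf S v = v ∈ S × ∣ S ∩ nbhd v ∣ ≤ 1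

  count : Colour → Subset n → ℕ
  count c S = ∣ S ∩ colourSet c ∣

  -- Balanced positions (well-founded since positions are finite):
  -- (i) every position reachable in one move (removing any leaf, of either
  --     colour, i.e. by either player) is balanced;
  -- (ii) if all leaves have colour c then at least half the vertices have colour c.
  data Balanced (S : Subset n) : Set where
    balanced :
      (∀ v → IsLeaf S v → Balanced (S - v)) →
      (∀ c → (∀ v → IsLeaf S v → col v ≡ c) → ∣ S ∣ ≤ 2 * count c S) →
      Balanced S

-- Condition (i) of balancedness is inherited along leaf removals, so it suffices to
-- prove (ii) for every vertex set S of the tree, and the argument only uses that the
-- graph is a forest. Suppose every leaf of S has colour c, and call a vertex of the
-- other colour branching in S if it has at least two neighbours in S; then every
-- vertex of S of the other colour is branching. Removing leaves one at a time shows
-- that there are at most as many branching vertices as vertices of colour c: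
-- removing a leaf of colour c lowers the c-count by one and destroys at most one
-- branching vertex (its only neighbour), while removing a leaf of the other colour
-- changes neither number, its neighbours having colour c. A leaf to remove always
-- exists, since the endpoint of a maximal path in S has at most one neighbour in S.
module Submission where

open import Defs
open import Data.Nat using (ℕ)
open import Data.Fin using (Fin)
open import Data.Fin.Subset using (⊤)

open import Data.Bool using (Bool; true)
import Data.Bool as Bool
open import Data.Bool.Properties using (T-≡)
open import Data.Empty using (⊥-elim)
open import Data.Fin using (zero; suc)
open import Data.Fin.Properties using (suc-injective) renaming (_≟_ to _≟ᶠ_)
open import Data.Fin.Subset
  using (Subset; Nonempty; _∈_; _⊆_; _⊂_; _∩_; _∪_; _-_; ∣_∣; inside; outside)
open import Data.Fin.Subset.Properties
  using ( x∈p∩q⁺; x∈p∩q⁻; ∣p∩q∣≤∣p∣; x∈p∪q⁺; p─q⊆p; x∈p∧x≢y⇒x∈p-y; x∈p⇒p-x⊂p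
        ; x∈p⇒∣p-x∣<∣p∣; p⊆q⇒∣p∣≤∣q∣; p⊂q⇒∣p∣<∣q∣; nonempty?; Empty-unique
        ; ∣⊥∣≡0; ∈⊤; ∣⊤∣≡n)
open import Data.Fin.Subset.Induction using (Acc; acc; ⊂-wellFounded)
open import Data.List using (List; []; _∷_; _++_; length)
open import Data.List.Membership.Propositional using () renaming (_∈_ to _∈ₗ_)
open import Data.List.Membership.Propositional.Properties using (∈-∃++)
import Data.List.Membership.DecPropositional as DecMembership
open import Data.List.Relation.Unary.All as All using (All; []; _∷_)
open import Data.List.Relation.Unary.All.Properties using (++⁻ˡ; ++⁻ʳ; ¬Any⇒All¬)
open import Data.List.Relation.Unary.AllPairs using ([]; _∷_)
open import Data.List.Relation.Unary.Any using (here; there)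
open import Data.List.Relation.Unary.Linked using (Linked; []; [-]; _∷_)
open import Data.List.Relation.Unary.Unique.Propositional using (Unique)
open import Data.Nat using (zero; suc; _≤_; _<_; _+_; _*_; _≤ᵇ_; z≤n; s≤s; s≤s⁻¹)
open import Data.Nat.Properties
  using ( ≤-trans; n≤1+n; +-suc; +-comm; +-identityʳ; +-mono-≤; +-monoʳ-≤
        ; m<m+n; <⇒≱; ≰⇒>; _≤?_; ≤ᵇ⇒≤; ≤⇒≤ᵇ; module ≤-Reasoning)
open import Data.Product using (∃; _×_; _,_; proj₁; proj₂; map₂)
open import Data.Sum using (_⊎_; inj₁; inj₂; [_,_])
import Data.Sum as Sum
open import Data.Vec using ([]; _∷_; tabulate; here; there)
open import Data.Vec.Properties using (lookup∘tabulate; lookup⇒[]=; []=⇒lookup)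
open import Function using (id; _∘_; Equivalence)
open import Relation.Binary.PropositionalEquality
  using (_≡_; _≢_; refl; sym; trans; subst; cong; ≢-sym)
open import Relation.Nullary using (yes; no; ¬_; contradiction)

private
  variable
    m : ℕ
    p : Subset m
    x : Fin m

∣p∪q∣≤∣p∣+∣q∣ : ∀ (p q : Subset m) → ∣ p ∪ q ∣ ≤ ∣ p ∣ + ∣ q ∣
∣p∪q∣≤∣p∣+∣q∣ []            []            = z≤n
∣p∪q∣≤∣p∣+∣q∣ (outside ∷ p) (outside ∷ q) = ∣p∪q∣≤∣p∣+∣q∣ p q
∣p∪q∣≤∣p∣+∣q∣ (inside  ∷ p) (outside ∷ q) = s≤s (∣p∪q∣≤∣p∣+∣q∣ p q)
∣p∪q∣≤∣p∣+∣q∣ (outside ∷ p) (inside  ∷ q) =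
  subst (suc ∣ p ∪ q ∣ ≤_) (sym (+-suc ∣ p ∣ ∣ q ∣)) (s≤s (∣p∪q∣≤∣p∣+∣q∣ p q))
∣p∪q∣≤∣p∣+∣q∣ (inside  ∷ p) (inside  ∷ q) =
  s≤s (≤-trans (∣p∪q∣≤∣p∣+∣q∣ p q) (+-monoʳ-≤ ∣ p ∣ (n≤1+n ∣ q ∣)))

x∉p-x : ∀ (p : Subset m) x → ¬ x ∈ p - x
x∉p-x (_ ∷ p) zero    ()
x∉p-x (_ ∷ p) (suc x) (there x∈p-x) = x∉p-x p x x∈p-x

p-x∩q⊆p∩q : ∀ (p : Subset m) x q → (p - x) ∩ q ⊆ p ∩ q
p-x∩q⊆p∩q p x q y∈ =
  let (y∈p-x , y∈q) = x∈p∩q⁻ (p - x) q y∈ in x∈p∩q⁺ (p─q⊆p p _ y∈p-x , y∈q)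

x∈tabulate⁺ : ∀ {f : Fin m → Bool} → f x ≡ true → x ∈ tabulate f
x∈tabulate⁺ {x = x} {f} fx = lookup⇒[]= x (tabulate f) (trans (lookup∘tabulate f x) fx)

x∈tabulate⁻ : ∀ {f : Fin m → Bool} → x ∈ tabulate f → f x ≡ true
x∈tabulate⁻ {x = x} {f} x∈ = trans (sym (lookup∘tabulate f x)) ([]=⇒lookup x∈)

1≤∣p∣⇒Nonempty : ∀ (p : Subset m) → 1 ≤ ∣ p ∣ → Nonempty p
1≤∣p∣⇒Nonempty (inside  ∷ p) _ = zero , here
1≤∣p∣⇒Nonempty (outside ∷ p) h =
  let (x , x∈p) = 1≤∣p∣⇒Nonempty p h in suc x , there x∈p

2≤∣p∣⇒∃≢ : ∀ (p : Subset m) → 2 ≤ ∣ p ∣ → ∀ y → ∃ λ x → x ∈ p × x ≢ y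
2≤∣p∣⇒∃≢ (inside  ∷ p) h zero =
  let (x , x∈p) = 1≤∣p∣⇒Nonempty p (s≤s⁻¹ h) in suc x , there x∈p , λ ()
2≤∣p∣⇒∃≢ (outside ∷ p) h zero =
  let (x , x∈p) = 1≤∣p∣⇒Nonempty p (≤-trans (n≤1+n 1) h) in suc x , there x∈p , λ ()
2≤∣p∣⇒∃≢ (inside  ∷ p) h (suc y) = zero , here , λ ()
2≤∣p∣⇒∃≢ (outside ∷ p) h (suc y) =
  let (x , x∈p , x≢y) = 2≤∣p∣⇒∃≢ p h y in suc x , there x∈p , x≢y ∘ suc-injective

length-Unique≤∣p∣ : ∀ {xs} → Unique xs → All (_∈ p) xs → length xs ≤ ∣ p ∣
length-Unique≤∣p∣ {xs = []}     []         []           = z≤n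
length-Unique≤∣p∣ {p = p} {xs = x ∷ xs} (x≢xs ∷ u) (x∈p ∷ xs⊆p) =
  ≤-trans (s≤s (length-Unique≤∣p∣ u xs⊆p-x)) (x∈p⇒∣p-x∣<∣p∣ x∈p)
  where
  xs⊆p-x : All (_∈ p - x) xs
  xs⊆p-x = All.zipWith (λ (y∈p , x≢y) → x∈p∧x≢y⇒x∈p-y y∈p (≢-sym x≢y)) (xs⊆p , x≢xs)

length-Unique≤ : ∀ {xs : List (Fin m)} → Unique xs → length xs ≤ m
length-Unique≤ {m} {xs} u =
  subst (length xs ≤_) (∣⊤∣≡n m) (length-Unique≤∣p∣ u (All.tabulate (λ _ → ∈⊤)))

Unique-rotate : ∀ {A : Set} xs {y : A} {ys} → Unique (xs ++ y ∷ ys) → Unique (y ∷ xs)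
Unique-rotate []       (_ ∷ _) = [] ∷ []
Unique-rotate (x ∷ xs) (x≢ ∷ u) with Unique-rotate xs u
... | y≢xs ∷ uxs = (≢-sym (All.head (++⁻ʳ xs x≢)) ∷ y≢xs) ∷ (++⁻ˡ xs x≢ ∷ uxs)

Linked-prefix : ∀ {A : Set} {R : A → A → Set} xs {y ys} →
                Linked R (xs ++ y ∷ ys) → Linked R (xs ++ y ∷ [])
Linked-prefix []            _        = [-]
Linked-prefix (x ∷ [])      (r ∷ _)  = r ∷ [-]
Linked-prefix (x ∷ x′ ∷ xs) (r ∷ rs) = r ∷ Linked-prefix (x′ ∷ xs) rs

other : Colour → Colour
other white = black
other black = white

other≢ : ∀ c → other c ≢ c
other≢ white ()
other≢ black ()

≡⊎≡other : ∀ a c → a ≡ c ⊎ a ≡ other c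
≡⊎≡other white white = inj₁ refl
≡⊎≡other white black = inj₂ refl
≡⊎≡other black white = inj₂ refl
≡⊎≡other black black = inj₁ refl

module LeafRemoval {n} (E : Graph n) (col : Fin n → Colour)
                   (simple : IsSimple E) (acyclic : Acyclic E) where

  open Game E col
  open DecMembership (_≟ᶠ_ {n}) using (_∈?_)

  private
    variable
      S : Subset n
      u v w : Fin n

  Adj-sym : Adj E u v → Adj E v u
  Adj-sym {u} {v} u~v = trans (proj₁ simple v u) u~v

  deg : Subset n → Fin n → ℕ
  deg S u = ∣ S ∩ nbhd u ∣

  ∈S∩nbhd⁻ : w ∈ S ∩ nbhd v → w ∈ S × Adj E v w
  ∈S∩nbhd⁻ {S = S} {v} w∈ = map₂ x∈tabulate⁻ (x∈p∩q⁻ S (nbhd v) w∈)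

  ∈S∩nbhd⁺ : w ∈ S → Adj E v w → w ∈ S ∩ nbhd v
  ∈S∩nbhd⁺ w∈S v~w = x∈p∩q⁺ (w∈S , x∈tabulate⁺ v~w)

  previous : Fin n → List (Fin n) → Fin n
  previous x []      = x
  previous _ (y ∷ _) = y

  back-edge⇒Cycle : ∀ p → w ∈ₗ p → w ≢ previous v p → Unique (v ∷ p) →
                    Linked (Adj E) (v ∷ p) → Adj E v w → Cycle E
  back-edge⇒Cycle (y ∷ p) (here w≡y)  w≢y _ _ _ = contradiction w≡y w≢y
  back-edge⇒Cycle {w = w} {v = v} (y ∷ p) (there w∈p) _ u l v~w with ∈-∃++ w∈p
  ... | as , bs , refl = w , v ∷ y ∷ as , s≤s (s≤s z≤n) ,
                         Unique-rotate (v ∷ y ∷ as) u ,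
                         Adj-sym v~w ∷ Linked-prefix (v ∷ y ∷ as) l

  -- The path v ∷ p lists the most recent vertex first; the fuel k cannot run out
  -- because a path has at most n vertices.
  walk : ∀ S k v p → v ∈ S → Unique (v ∷ p) → Linked (Adj E) (v ∷ p) →
         n < k + length (v ∷ p) → ∃ (IsLeaf S)
  walk S zero    v p _ u _ n<len = contradiction (length-Unique≤ u) (<⇒≱ n<len)
  walk S (suc k) v p v∈S u l n<len with deg S v ≤? 1
  ... | yes leaf = v , v∈S , leaf
  ... | no ¬leaf with 2≤∣p∣⇒∃≢ (S ∩ nbhd v) (≰⇒> ¬leaf) (previous v p)
  ... | w , w∈N , w≢prev with ∈S∩nbhd⁻ w∈N | w ∈? v ∷ p
  ... | _   , v~w | yes (here refl) = contradiction (trans (sym v~w) (proj₂ simple v)) λ ()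
  ... | _   , v~w | yes (there w∈p) = ⊥-elim (acyclic (back-edge⇒Cycle p w∈p w≢prev u l v~w))
  ... | w∈S , v~w | no w∉ =
    walk S k w (v ∷ p) w∈S (¬Any⇒All¬ (v ∷ p) w∉ ∷ u) (Adj-sym v~w ∷ l)
         (subst (n <_) (sym (+-suc k (length (v ∷ p)))) n<len)

  leaf-exists : v ∈ S → ∃ (IsLeaf S)
  leaf-exists {v = v} {S = S} v∈S = walk S n v [] v∈S ([] ∷ []) [-] (m<m+n n (s≤s z≤n))

  ∈colourSet⁺ : ∀ {c} → col v ≡ c → v ∈ colourSet c
  ∈colourSet⁺ {v = v} refl = x∈tabulate⁺ (sameColour-refl (col v))
    where
    sameColour-refl : ∀ c → sameColour c c ≡ true
    sameColour-refl white = refl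
    sameColour-refl black = refl

  ∈colourSet⁻ : ∀ {c} → v ∈ colourSet c → col v ≡ c
  ∈colourSet⁻ {v = v} v∈ = sameColour⇒≡ (col v) _ (x∈tabulate⁻ v∈)
    where
    sameColour⇒≡ : ∀ a c → sameColour a c ≡ true → a ≡ c
    sameColour⇒≡ white white _ = refl
    sameColour⇒≡ black black _ = refl

  count-remove-≤ : ∀ c S v → count c (S - v) ≤ count c S
  count-remove-≤ c S v = p⊆q⇒∣p∣≤∣q∣ (p-x∩q⊆p∩q S v (colourSet c))

  count-remove-< : ∀ {c} → v ∈ S → col v ≡ c → count c (S - v) < count c S
  count-remove-< {v = v} {S = S} {c} v∈S cv≡c = p⊂q⇒∣p∣<∣q∣
    ( p-x∩q⊆p∩q S v (colourSet c)
    , v , x∈p∩q⁺ (v∈S , ∈colourSet⁺ cv≡c) , x∉p-x S v ∘ proj₁ ∘ x∈p∩q⁻ (S - v) (colourSet c))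

  deg-remove-nonadjacent : ∀ S → ¬ Adj E u v → deg S u ≤ deg (S - v) u
  deg-remove-nonadjacent {u} {v} S u≁v = p⊆q⇒∣p∣≤∣q∣ nbhd-kept
    where
    nbhd-kept : S ∩ nbhd u ⊆ (S - v) ∩ nbhd u
    nbhd-kept w∈ = let (w∈S , u~w) = ∈S∩nbhd⁻ w∈
                   in ∈S∩nbhd⁺ (x∈p∧x≢y⇒x∈p-y w∈S λ { refl → u≁v u~w }) u~w

  branching : Colour → Subset n → Subset n
  branching a S = S ∩ colourSet a ∩ tabulate (λ u → 2 ≤ᵇ deg S u)

  ∈branching⁺ : ∀ {a} → u ∈ S → col u ≡ a → 2 ≤ deg S u → u ∈ branching a S
  ∈branching⁺ u∈S cu≡a 2≤deg =
    x∈p∩q⁺ (u∈S , x∈p∩q⁺ (∈colourSet⁺ cu≡a , x∈tabulate⁺ (Equivalence.to T-≡ (≤⇒≤ᵇ 2≤deg))))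

  ∈branching⁻ : ∀ {a} → u ∈ branching a S → u ∈ S × col u ≡ a × 2 ≤ deg S u
  ∈branching⁻ {u = u} {S = S} {a} u∈ =
    let (u∈S , u∈rest) = x∈p∩q⁻ S _ u∈
        (u∈C , u∈D)    = x∈p∩q⁻ (colourSet a) _ u∈rest
    in u∈S , ∈colourSet⁻ u∈C , ≤ᵇ⇒≤ 2 (deg S u) (Equivalence.from T-≡ (x∈tabulate⁻ u∈D))

  module _ (chess : IsChess E col) where

    branching-remove : ∀ {a} → IsLeaf S v → u ∈ branching a S →
                       u ∈ branching a (S - v) ⊎ (u ∈ S ∩ nbhd v × col v ≢ a)
    branching-remove {S} {v} {u} (_ , deg≤1) u∈ with ∈branching⁻ u∈ | E u v Bool.≟ true
    ... | u∈S , cu≡a , _      | yes u~v =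
      inj₂ (∈S∩nbhd⁺ u∈S (Adj-sym u~v) , λ cv≡a → chess u v u~v (trans cu≡a (sym cv≡a)))
    ... | u∈S , cu≡a , 2≤deg | no u≁v =
      inj₁ (∈branching⁺ (x∈p∧x≢y⇒x∈p-y u∈S u≢v) cu≡a
                        (≤-trans 2≤deg (deg-remove-nonadjacent S u≁v)))
      where
      u≢v : u ≢ v
      u≢v refl = <⇒≱ 2≤deg deg≤1

    branching≤count : ∀ c S → Acc _⊂_ S → ∣ branching (other c) S ∣ ≤ count c S
    branching≤count c S (acc smaller) with nonempty? S
    ... | no S-empty = begin
      ∣ branching (other c) S ∣ ≤⟨ ∣p∩q∣≤∣p∣ S (colourSet (other c) ∩ _) ⟩
      ∣ S ∣                     ≡⟨ trans (cong ∣_∣ (Empty-unique S-empty)) (∣⊥∣≡0 n) ⟩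
      0                         ≤⟨ z≤n ⟩
      count c S                 ∎
      where open ≤-Reasoning
    ... | yes (_ , x∈S) with leaf-exists x∈S
    ... | v , leaf@(v∈S , deg≤1) with ≡⊎≡other (col v) c
    ... | inj₁ cv≡c = begin
      ∣ branching (other c) S ∣
        ≤⟨ p⊆q⇒∣p∣≤∣q∣ shrink ⟩
      ∣ branching (other c) (S - v) ∪ (S ∩ nbhd v) ∣
        ≤⟨ ∣p∪q∣≤∣p∣+∣q∣ (branching (other c) (S - v)) (S ∩ nbhd v) ⟩
      ∣ branching (other c) (S - v) ∣ + deg S v
        ≤⟨ +-mono-≤ IH deg≤1 ⟩
      count c (S - v) + 1
        ≡⟨ +-comm _ 1 ⟩
      suc (count c (S - v))
        ≤⟨ count-remove-< v∈S cv≡c ⟩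
      count c S ∎
      where
      open ≤-Reasoning
      shrink : branching (other c) S ⊆ branching (other c) (S - v) ∪ (S ∩ nbhd v)
      shrink u∈ = x∈p∪q⁺ (Sum.map₂ proj₁ (branching-remove leaf u∈))
      IH : ∣ branching (other c) (S - v) ∣ ≤ count c (S - v)
      IH = branching≤count c (S - v) (smaller (x∈p⇒p-x⊂p v∈S))
    ... | inj₂ cv≡other = begin
      ∣ branching (other c) S ∣       ≤⟨ p⊆q⇒∣p∣≤∣q∣ shrink ⟩
      ∣ branching (other c) (S - v) ∣ ≤⟨ IH ⟩
      count c (S - v)                 ≤⟨ count-remove-≤ c S v ⟩
      count c S                       ∎
      where
      open ≤-Reasoning
      shrink : branching (other c) S ⊆ branching (other c) (S - v)
      shrink u∈ = [ id , (λ (_ , cv≢other) → contradiction cv≡other cv≢other) ]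
                  (branching-remove leaf u∈)
      IH : ∣ branching (other c) (S - v) ∣ ≤ count c (S - v)
      IH = branching≤count c (S - v) (smaller (x∈p⇒p-x⊂p v∈S))

    leaves-coloured⇒half : ∀ c → (∀ v → IsLeaf S v → col v ≡ c) → ∣ S ∣ ≤ 2 * count c S
    leaves-coloured⇒half {S} c leaves-c = begin
      ∣ S ∣
        ≤⟨ p⊆q⇒∣p∣≤∣q∣ split ⟩
      ∣ (S ∩ colourSet c) ∪ branching (other c) S ∣
        ≤⟨ ∣p∪q∣≤∣p∣+∣q∣ (S ∩ colourSet c) (branching (other c) S) ⟩
      count c S + ∣ branching (other c) S ∣
        ≤⟨ +-monoʳ-≤ (count c S) (branching≤count c S (⊂-wellFounded S)) ⟩
      count c S + count c S
        ≡⟨ cong (count c S +_) (sym (+-identityʳ _)) ⟩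
      2 * count c S ∎
      where
      open ≤-Reasoning
      split : S ⊆ (S ∩ colourSet c) ∪ branching (other c) S
      split {u} u∈S with ≡⊎≡other (col u) c | deg S u ≤? 1
      ... | inj₁ cu≡c     | _        = x∈p∪q⁺ (inj₁ (x∈p∩q⁺ (u∈S , ∈colourSet⁺ cu≡c)))
      ... | inj₂ cu≡other | yes leaf =
        ⊥-elim (other≢ c (trans (sym cu≡other) (leaves-c u (u∈S , leaf))))
      ... | inj₂ cu≡other | no ¬leaf = x∈p∪q⁺ (inj₂ (∈branching⁺ u∈S cu≡other (≰⇒> ¬leaf)))

    balanced-from : ∀ S → Acc _⊂_ S → Balanced S
    balanced-from S (acc smaller) =
      balanced (λ v (v∈S , _) → balanced-from (S - v) (smaller (x∈p⇒p-x⊂p v∈S)))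
               leaves-coloured⇒half

mainTheorem10 : (n : ℕ) (E : Graph n) (col : Fin n → Colour) →
                IsTree E → IsChess E col → Game.Balanced E col ⊤
mainTheorem10 n E col (_ , simple , _ , acyclic) chess =
  LeafRemoval.balanced-from E col simple acyclic chess ⊤ (⊂-wellFounded ⊤)
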